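{- Let $T$ be a string of length $n$, $i$ a position in $T$, and $h\ge 1$. Suppose $M_1,M_2,\dots,M_{h+1}$ are $h+1$ distinct MUSs of $T$ that contain position $i$, where $M_k=T[b_k..e_k]$ and $b_1<b_2<\dots<b_{h+1}$. For $1\le k\le h$ let $s_k=T[b_k+1..e_k]$, choose an occurrence $[j_k..j_k+|s_k|-1]$ of $s_k$ in $T$ with $j_k\ne b_k+1$, and let $i_k=j_k+(i-b_k-1)$ (the position in this occurrence corresponding to position $i$ in $s_k$). Let $f$ be a permutation of $\{1,\dots,h\}$ such that $i_{f(1)}\le i_{f(2)}\le\dots\le i_{f(h)}$. Then for every $1\le x\le h-2$, $$i_{f(x+2)}-i_{f(x)}>h-\omega,\qquad\text{where }\omega=\max\{f(x),f(x+1),f(x+2)\}.$$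
   Context: Strings are finite sequences over an alphabet $\Sigma$. For a string $T$ of length $n$, $T[i]$ is its $i$-th character and $T[i..j]$ is the substring from position $i$ to position $j$ (empty if $i>j$). An interval $[i..j]$ is an occurrence of a string $w$ in $T$ if $T[i..j]=w$; $\mathsf{occ}_T(w)$ is the number of occurrences of $w$ in $T$, with the convention $\mathsf{occ}_T(\varepsilon)=|T|+1$. A substring $w$ of $T$ is unique if $\mathsf{occ}_T(w)=1$. A unique substring $w$ of $T$ is a minimal unique substring (MUS) of $T$ if $\mathsf{occ}_T(w[1..|w|-1])\ge 2$ and $\mathsf{occ}_T(w[2..|w|])\ge 2$; a MUS is identified with its unique occurrence $[k..j]$, and it contains position $i$ if $k\le i\le j$. (By the definition of MUS, the occurrences of $s_k$ with $j_k\neq b_k+1$ required in the statement exist.) -}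

module Defs where

open import Data.Nat using (ℕ; zero; suc; _+_; _∸_; _≤_; _<_)
open import Data.Fin using (Fin; fromℕ<)
open import Data.Vec using (Vec; lookup)
open import Data.Product using (_×_; ∃-syntax)
open import Relation.Binary.PropositionalEquality using (_≡_; _≢_)

-- Positions in a string T : Vec A n are 0-indexed: 0 , … , n-1.
-- A substring is given by its start position k and its length m,
-- i.e. T[k .. k+m-1]; the empty string (m = 0) is allowed.

OccAt : {A : Set} {n : ℕ} → Vec A n → (k m p : ℕ) → Set
OccAt {n = n} T k m p =
  (k + m ≤ n) × (p + m ≤ n) ×
  (∀ t → t < m → (h₁ : k + t < n) (h₂ : p + t < n) →
     lookup T (fromℕ< h₁) ≡ lookup T (fromℕ< h₂))

UniqueSub : {A : Set} {n : ℕ} → Vec A n → (k m : ℕ) → Set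
UniqueSub {n = n} T k m = (k + m ≤ n) × (∀ p → OccAt T k m p → p ≡ k)

Repeated : {A : Set} {n : ℕ} → Vec A n → (k m : ℕ) → Set
Repeated T k m = ∃[ p ] ∃[ q ] (p ≢ q × OccAt T k m p × OccAt T k m q)

-- [b .. e] (inclusive, b ≤ e) is (the occurrence of) a minimal unique
-- substring w = T[b..e] of T: w is unique, and both w[1..|w|-1] = T[b..e-1]
-- and w[2..|w|] = T[b+1..e] occur at least twice.
IsMUS : {A : Set} {n : ℕ} → Vec A n → (b e : ℕ) → Set
IsMUS T b e =
  (b ≤ e) × UniqueSub T b (suc e ∸ b) ×
  Repeated T b (e ∸ b) × Repeated T (suc b) (e ∸ b)

Contains : (b e i : ℕ) → Set
Contains b e i = (b ≤ i) × (i ≤ e)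

module Submission where

-- Write d_k = j_k - b_k - 1: the suffix window [b_k+1 .. e_k] of M_k recurs shifted by d_k ≠ 0,
-- and i_k = i + d_k. Were i_{f(x+2)} - i_{f(x)} ≤ h - ω, the three shifts would lie in an
-- interval shorter than [b+1 .. i], where b begins the latest of the three MUSs (the h + 1 - ω
-- MUSs beginning after it still begin by i). All three windows cover that stretch, so differences of
-- shifts are local periods there. Two equal shifts, or a latest MUS whose shift is not the
-- smallest, make a MUS recur directly; otherwise a Fine–Wilf style propagation of these periods
-- does. Either way a MUS would not be unique.

open import Data.Empty using (⊥; ⊥-elim)
open import Data.Fin as F using (Fin; toℕ; inject₁)
open import Data.Fin.Permutation using (Permutation′; _⟨$⟩ʳ_)
open import Data.Integer using (ℤ; +_; _-_)
import Data.Integer as Z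
open import Data.Product using (_×_; _,_; proj₁; proj₂; ∃-syntax)
open import Data.Vec using (Vec; lookup)
open import Function using (_∘_)
open import Relation.Binary.PropositionalEquality
open import Defs

-- Inside this block ≤ and < are the order of ℤ; the statement at the end uses them on ℕ.
module _ where
  open import Algebra.Bundles using (AbelianGroup)
  open import Data.Fin using (fromℕ<; fromℕ)
  import Data.Fin.Properties as Fₚ
  open import Data.Integer using (-[1+_]; 0ℤ; 1ℤ; -1ℤ; _+_; -_; _≤_; _<_; ∣_∣; +≤+; +<+)
  open import Data.Integer.Properties
    using ( +-mono-≤; +-monoˡ-≤; i≤j⇒0≤j-i; 0≤i-j⇒j≤i; i<j⇒suc[i]≤j; suc[i]≤j⇒i<j
          ; ≤-refl; ≤-reflexive; ≤-trans; <-trans; <⇒≤; ≤-antisym; _≤?_; ≰⇒>; <-cmp; <⇒≢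
          ; neg-involutive; neg-mono-≤; neg-mono-<; 0≤i⇒+∣i∣≡i
          ; drop‿+≤+; pos-+; m-n≡m⊖n; ⊖-≥; +-injective; +-0-abelianGroup; +-identityˡ )
  open import Algebra.Properties.Group (AbelianGroup.group +-0-abelianGroup)
    using () renaming (identityʳ-unique to +-identityʳ-unique)
  open import Data.Integer.Tactic.RingSolver using (solve)
  open import Data.List using (_∷_; [])
  open import Data.Maybe using (Maybe; just; nothing)
  open import Data.Maybe.Properties using (just-injective)
  open import Data.Nat as ℕ using (ℕ; zero; suc; _⊔_)
  import Data.Nat.Properties as ℕₚ
  open import Function.Bundles using (Injection)
  open import Function.Properties.Inverse using (↔⇒↣)
  open import Relation.Binary.Bundles using (StrictTotalOrder)
  open import Relation.Binary.Definitions using (tri<; tri≈; tri>)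
  open import Relation.Nullary using (¬_; yes; no)
  open ≡-Reasoning

  infix 4 _∈[_,_]
  _∈[_,_] : ℤ → ℤ → ℤ → Set
  x ∈[ lo , hi ] = lo ≤ x × x ≤ hi

  -- Linear side conditions are proved by writing the difference of the two sides
  -- as a sum of known nonnegative terms, the identity being checked by the ring solver.
  infixl 6 _⊕_
  _⊕_ : ∀ {x y} → 0ℤ ≤ x → 0ℤ ≤ y → 0ℤ ≤ x + y
  _⊕_ = +-mono-≤

  diff : ∀ {x y} → x ≤ y → 0ℤ ≤ y - x
  diff = i≤j⇒0≤j-i

  ≤-by : ∀ {s x y} → 0ℤ ≤ s → s ≡ y - x → x ≤ y
  ≤-by 0≤s refl = 0≤i-j⇒j≤i 0≤s

  diff< : ∀ {x y} → x < y → 0ℤ ≤ y - x - 1ℤ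
  diff< {x} {y} x<y = ≤-by (diff {1ℤ + x} (i<j⇒suc[i]≤j x<y)) (solve (x ∷ y ∷ []))

  one : 0ℤ ≤ 1ℤ
  one = +≤+ ℕ.z≤n

  <-by : ∀ {s x y} → 0ℤ ≤ s → s ≡ y - x - 1ℤ → x < y
  <-by {x = x} {y} 0≤s refl = suc[i]≤j⇒i<j (≤-by {x = 1ℤ + x} 0≤s (solve (x ∷ y ∷ [])))

  ⊥-by : ∀ {s} → 0ℤ ≤ s → s ≡ -1ℤ → ⊥
  ⊥-by () refl

  0<-diff : ∀ {x y} → x < y → 0ℤ < y - x
  0<-diff {x} {y} x<y = <-by (diff< x<y) (solve (x ∷ y ∷ []))

  ≥-rec : ∀ {ℓ} (P : ℤ → Set ℓ) {lo : ℤ} →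
          (∀ r → lo ≤ r → (∀ s → lo ≤ s → s < r → P s) → P r) →
          ∀ r → lo ≤ r → P r
  ≥-rec P {lo} step r lo≤r = go ∣ r - lo ∣ r lo≤r (≤-reflexive (begin
    r                  ≡⟨ solve (r ∷ lo ∷ []) ⟩
    lo + (r - lo)      ≡⟨ cong (λ x → lo + x) (0≤i⇒+∣i∣≡i (diff lo≤r)) ⟨
    lo + + ∣ r - lo ∣  ∎))
    where
    below : ∀ {s r N} → s < r → r ≤ lo + (1ℤ + N) → s ≤ lo + N
    below {s} {r} {N} s<r r≤ = ≤-by (diff< s<r ⊕ diff r≤) (solve (s ∷ r ∷ lo ∷ N ∷ []))

    go : ∀ n r → lo ≤ r → r ≤ lo + + n → P r
    go zero r lo≤r r≤ = step r lo≤r λ s lo≤s s<r →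
      ⊥-elim (⊥-by (diff lo≤s ⊕ diff< s<r ⊕ diff r≤) (solve (s ∷ r ∷ lo ∷ [])))
    go (suc n) r lo≤r r≤ = step r lo≤r λ s lo≤s s<r →
      go n s lo≤s (below {N = + n} s<r r≤)

  ≤-rec : ∀ {ℓ} (P : ℤ → Set ℓ) {hi : ℤ} →
          (∀ r → r ≤ hi → (∀ s → s ≤ hi → r < s → P s) → P r) →
          ∀ r → r ≤ hi → P r
  ≤-rec P {hi} step r r≤hi =
    subst P (neg-involutive r) (≥-rec (P ∘ -_) step′ (- r) (neg-mono-≤ r≤hi))
    where
    step′ : ∀ r → - hi ≤ r → (∀ s → - hi ≤ s → s < r → P (- s)) → P (- r)
    step′ r -hi≤r ih = step (- r) (subst (- r ≤_) (neg-involutive hi) (neg-mono-≤ -hi≤r)) λ s s≤hi -r<s →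
      subst P (neg-involutive s)
        (ih (- s) (neg-mono-≤ s≤hi) (subst (- s <_) (neg-involutive r) (neg-mono-< -r<s)))

  Matches : {B : Set} → (ℤ → B) → ℤ → ℤ → ℤ → Set
  Matches f d lo hi = ∀ q → q ∈[ lo , hi ] → f q ≡ f (q + d)

  Unique : {B : Set} → (ℤ → B) → ℤ → ℤ → Set
  Unique f lo hi = ∀ d → Matches f d lo hi → d ≡ 0ℤ

  module _ {B : Set} {f : ℤ → B} where

    matches-mono : ∀ {d lo hi lo′ hi′} → lo ≤ lo′ → hi′ ≤ hi → Matches f d lo hi → Matches f d lo′ hi′
    matches-mono lo≤lo′ hi′≤hi M q (lo′≤q , q≤hi′) =
      M q (≤-trans lo≤lo′ lo′≤q , ≤-trans q≤hi′ hi′≤hi)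

    matches-cons : ∀ {d lo hi} → f lo ≡ f (lo + d) → Matches f d (lo + 1ℤ) hi → Matches f d lo hi
    matches-cons {lo = lo} at-lo M q (lo≤q , q≤hi) with q ≤? lo
    ... | yes q≤lo rewrite ≤-antisym q≤lo lo≤q = at-lo
    ... | no q≰lo  = M q (≤-by (diff< (≰⇒> q≰lo)) (solve (q ∷ lo ∷ [])) , q≤hi)

    matches-neg : ∀ {d lo hi} → Matches f d lo hi → Matches f (- d) (lo + d) (hi + d)
    matches-neg {d} {lo} {hi} M q (lo+d≤q , q≤hi+d) = begin
      f q                ≡⟨ cong f (solve (q ∷ d ∷ [])) ⟩
      f ((q - d) + d)    ≡⟨ M (q - d) ( ≤-by (diff lo+d≤q) (solve (q ∷ d ∷ lo ∷ []))
                                      , ≤-by (diff q≤hi+d) (solve (q ∷ d ∷ hi ∷ []))) ⟨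
      f (q - d)          ∎

    matches-near : ∀ {dα lα hα dX lX hX lo hi} → Matches f dα lα hα → Matches f dX lX hX →
                   lX ≤ lo → hi ≤ hX → lα ≤ lo + (dX - dα) → hi + (dX - dα) ≤ hα →
                   Matches f (dX - dα) lo hi
    matches-near {dα} {dX = dX} Mα MX lX≤lo hi≤hX lα≤ ≤hα u (lo≤u , u≤hi) = begin
      f u                        ≡⟨ MX u (≤-trans lX≤lo lo≤u , ≤-trans u≤hi hi≤hX) ⟩
      f (u + dX)                 ≡⟨ cong f (solve (u ∷ dα ∷ dX ∷ [])) ⟩
      f (u + (dX - dα) + dα)     ≡⟨ Mα (u + (dX - dα)) ( ≤-trans lα≤ (+-monoˡ-≤ (dX - dα) lo≤u)
                                                       , ≤-trans (+-monoˡ-≤ (dX - dα) u≤hi) ≤hα) ⟨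
      f (u + (dX - dα))          ∎

    matches-far : ∀ {dα lα hα dX lX hX lo hi} → Matches f dα lα hα → Matches f dX lX hX →
                  lα ≤ lo → lX ≤ lo → hi ≤ hα → hi ≤ hX →
                  Matches (λ r → f (r + dα)) (dX - dα) lo hi
    matches-far {dα} {dX = dX} Mα MX lα≤lo lX≤lo hi≤hα hi≤hX r (lo≤r , r≤hi) = begin
      f (r + dα)              ≡⟨ Mα r (≤-trans lα≤lo lo≤r , ≤-trans r≤hi hi≤hα) ⟨
      f r                     ≡⟨ MX r (≤-trans lX≤lo lo≤r , ≤-trans r≤hi hi≤hX) ⟩
      f (r + dX)              ≡⟨ cong f (solve (r ∷ dα ∷ dX ∷ [])) ⟩
      f (r + (dX - dα) + dα)  ∎

    -- Windows α and X make dX - dα a period both at p and at p + dt - dα,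
    -- and window t carries the first of these positions to the second.
    matches-via : ∀ {dα lα hα dX lX hX dt lt ht p} →
                  Matches f dα lα hα → Matches f dX lX hX → Matches f dt lt ht →
                  p ∈[ lX , hX ] → p + (dX - dα) ∈[ lα , hα ] → p + (dX - dα) ∈[ lt , ht ] →
                  p + (dt - dα) ∈[ lα , hα ] → p + (dt - dα) ∈[ lX , hX ] →
                  f p ≡ f (p + dt)
    matches-via {dα} {dX = dX} {dt = dt} {p = p} Mα MX Mt
                (lX≤p , p≤hX) (lα≤p′ , p′≤hα) p′∈t (lα≤p″ , p″≤hα) (lX≤p″ , p″≤hX) = begin
      f p                                 ≡⟨ matches-near Mα MX lX≤p p≤hX lα≤p′ p′≤hα p (≤-refl , ≤-refl) ⟩
      f (p + (dX - dα))                   ≡⟨ Mt _ p′∈t ⟩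
      f (p + (dX - dα) + dt)              ≡⟨ cong f (solve (p ∷ dα ∷ dX ∷ dt ∷ [])) ⟩
      f (p + (dt - dα) + (dX - dα) + dα)  ≡⟨ matches-far Mα MX lα≤p″ lX≤p″ p″≤hα p″≤hX _
                                                          (≤-refl , ≤-refl) ⟨
      f (p + (dt - dα) + dα)              ≡⟨ cong f (solve (p ∷ dα ∷ dt ∷ [])) ⟩
      f (p + dt)                          ∎

    -- Fine–Wilf style propagation: a period q known on a stretch longer than the
    -- period p spreads over everything of period p (to the right, and symmetrically to the left).
    matches-extendʳ : ∀ {p q lo mid hi hi′} → 0ℤ < p → 0ℤ ≤ q → lo + p ≤ mid + 1ℤ → hi + q ≤ hi′ + p →
                      Matches f q lo mid → Matches f p lo hi′ → Matches f q lo hi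
    matches-extendʳ {p} {q} {lo} {mid} {hi} {hi′} 0<p 0≤q lo+p≤mid+1 hi+q≤hi′+p Mq Mp r (lo≤r , r≤hi) =
      ≥-rec (λ r → r ≤ hi → f r ≡ f (r + q)) step r lo≤r r≤hi
      where
      step : ∀ r → lo ≤ r → (∀ s → lo ≤ s → s < r → s ≤ hi → f s ≡ f (s + q)) →
             r ≤ hi → f r ≡ f (r + q)
      step r lo≤r ih r≤hi with r ≤? mid
      ... | yes r≤mid = Mq r (lo≤r , r≤mid)
      ... | no r≰mid = begin
        f r                ≡⟨ cong f (solve (r ∷ p ∷ [])) ⟩
        f (r - p + p)      ≡⟨ Mp (r - p) (lo≤r-p , r-p≤hi′) ⟨
        f (r - p)          ≡⟨ ih (r - p) lo≤r-p r-p<r r-p≤hi ⟩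
        f (r - p + q)      ≡⟨ Mp (r - p + q) (lo≤r-p+q , r-p+q≤hi′) ⟩
        f (r - p + q + p)  ≡⟨ cong f (solve (r ∷ p ∷ q ∷ [])) ⟩
        f (r + q)          ∎
        where
        mid<r : 0ℤ ≤ r - mid - 1ℤ
        mid<r = diff< (≰⇒> r≰mid)
        lo≤r-p : lo ≤ r - p
        lo≤r-p = ≤-by (mid<r ⊕ diff lo+p≤mid+1) (solve (r ∷ mid ∷ lo ∷ p ∷ []))
        r-p<r : r - p < r
        r-p<r = <-by (diff< 0<p) (solve (r ∷ p ∷ []))
        r-p≤hi : r - p ≤ hi
        r-p≤hi = ≤-by (diff r≤hi ⊕ diff< 0<p ⊕ one) (solve (r ∷ p ∷ hi ∷ []))
        r-p≤hi′ : r - p ≤ hi′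
        r-p≤hi′ = ≤-by (diff r≤hi ⊕ diff hi+q≤hi′+p ⊕ diff 0≤q) (solve (r ∷ p ∷ q ∷ hi ∷ hi′ ∷ []))
        lo≤r-p+q : lo ≤ r - p + q
        lo≤r-p+q = ≤-by (mid<r ⊕ diff lo+p≤mid+1 ⊕ diff 0≤q) (solve (r ∷ mid ∷ lo ∷ p ∷ q ∷ []))
        r-p+q≤hi′ : r - p + q ≤ hi′
        r-p+q≤hi′ = ≤-by (diff r≤hi ⊕ diff hi+q≤hi′+p) (solve (r ∷ p ∷ q ∷ hi ∷ hi′ ∷ []))

    matches-extendˡ : ∀ {p q lo mid hi hi′} → 0ℤ < p → 0ℤ ≤ q → mid + q ≤ hi′ + 1ℤ → mid + p ≤ hi + 1ℤ →
                      Matches f q mid hi → Matches f p lo hi′ → Matches f q lo hi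
    matches-extendˡ {p} {q} {lo} {mid} {hi} {hi′} 0<p 0≤q mid+q≤hi′+1 mid+p≤hi+1 Mq Mp r (lo≤r , r≤hi) =
      ≤-rec (λ r → lo ≤ r → f r ≡ f (r + q)) step r r≤hi lo≤r
      where
      step : ∀ r → r ≤ hi → (∀ s → s ≤ hi → r < s → lo ≤ s → f s ≡ f (s + q)) →
             lo ≤ r → f r ≡ f (r + q)
      step r r≤hi ih lo≤r with mid ≤? r
      ... | yes mid≤r = Mq r (mid≤r , r≤hi)
      ... | no mid≰r = begin
        f r            ≡⟨ Mp r (lo≤r , r≤hi′) ⟩
        f (r + p)      ≡⟨ ih (r + p) r+p≤hi r<r+p lo≤r+p ⟩
        f (r + p + q)  ≡⟨ cong f (solve (r ∷ p ∷ q ∷ [])) ⟩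
        f (r + q + p)  ≡⟨ Mp (r + q) (lo≤r+q , r+q≤hi′) ⟨
        f (r + q)      ∎
        where
        r<mid : 0ℤ ≤ mid - r - 1ℤ
        r<mid = diff< (≰⇒> mid≰r)
        r≤hi′ : r ≤ hi′
        r≤hi′ = ≤-by (r<mid ⊕ diff mid+q≤hi′+1 ⊕ diff 0≤q) (solve (r ∷ mid ∷ q ∷ hi′ ∷ []))
        r+p≤hi : r + p ≤ hi
        r+p≤hi = ≤-by (r<mid ⊕ diff mid+p≤hi+1) (solve (r ∷ mid ∷ p ∷ hi ∷ []))
        r<r+p : r < r + p
        r<r+p = <-by (diff< 0<p) (solve (r ∷ p ∷ []))
        lo≤r+p : lo ≤ r + p
        lo≤r+p = ≤-by (diff lo≤r ⊕ diff< 0<p ⊕ one) (solve (r ∷ lo ∷ p ∷ []))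
        lo≤r+q : lo ≤ r + q
        lo≤r+q = ≤-by (diff lo≤r ⊕ diff 0≤q) (solve (r ∷ lo ∷ q ∷ []))
        r+q≤hi′ : r + q ≤ hi′
        r+q≤hi′ = ≤-by (r<mid ⊕ diff mid+q≤hi′+1) (solve (r ∷ mid ∷ q ∷ hi′ ∷ []))

  -- l, m, w: three MUSs [bl..el], [bm..em], [a..ew] beginning in this order and containing i,
  -- whose suffix windows [b+1..e] recur at nonzero shifts lying in an interval [lo..hi]
  -- shorter than [a+1..i].
  module ThreeWindows {B : Set} (f : ℤ → B) {i a bl el dl bm em dm ew dw lo hi : ℤ}
    (bl<bm : bl < bm) (bm<a : bm < a) (i≤el : i ≤ el) (i≤em : i ≤ em) (i≤ew : i ≤ ew)
    (dl∈ : dl ∈[ lo , hi ]) (dm∈ : dm ∈[ lo , hi ]) (dw∈ : dw ∈[ lo , hi ])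
    (narrow : a + (hi - lo) < i)
    (Wl : Matches f dl (bl + 1ℤ) el) (Wm : Matches f dm (bm + 1ℤ) em) (Ww : Matches f dw (a + 1ℤ) ew)
    (dl≢0 : dl ≢ 0ℤ) (dm≢0 : dm ≢ 0ℤ) (dw≢0 : dw ≢ 0ℤ)
    (Um : Unique f bm em) (Uw : Unique f a ew)
    where

    bl<a : bl < a
    bl<a = <-by (diff< bl<bm ⊕ diff< bm<a ⊕ one) (solve (bl ∷ bm ∷ a ∷ []))

    a<i : a < i
    a<i = <-by (diff< narrow ⊕ diff (proj₁ dl∈) ⊕ diff (proj₂ dl∈)) (solve (a ∷ i ∷ lo ∷ hi ∷ dl ∷ []))

    bm≤i : bm ≤ i
    bm≤i = ≤-by (diff< bm<a ⊕ diff< a<i ⊕ one ⊕ one) (solve (bm ∷ a ∷ i ∷ []))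

    bm+1≤a : bm + 1ℤ ≤ a
    bm+1≤a = ≤-by (diff< bm<a) (solve (bm ∷ a ∷ []))

    bl+1≤bm : bl + 1ℤ ≤ bm
    bl+1≤bm = ≤-by (diff< bl<bm) (solve (bl ∷ bm ∷ []))

    bm∈Wl : bm ∈[ bl + 1ℤ , el ]
    bm∈Wl = bl+1≤bm , ≤-trans bm≤i i≤el

    ∈-weakenˡ : ∀ {x} → x ∈[ a + 1ℤ , i ] → x ∈[ a , i ]
    ∈-weakenˡ {x} (a+1≤x , x≤i) = ≤-by (diff a+1≤x ⊕ one) (solve (a ∷ x ∷ [])) , x≤i

    covered : ∀ {b e x} → b < a → i ≤ e → x ∈[ a , i ] → x ∈[ b + 1ℤ , e ]
    covered {b} {e} {x} b<a i≤e (a≤x , x≤i) =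
      ≤-by (diff< b<a ⊕ diff a≤x) (solve (b ∷ a ∷ x ∷ [])) , ≤-trans x≤i i≤e

    in-Ww : ∀ {x} → x ∈[ a + 1ℤ , i ] → x ∈[ a + 1ℤ , ew ]
    in-Ww (a+1≤x , x≤i) = a+1≤x , ≤-trans x≤i i≤ew

    offset∈ : ∀ {p x y} → p ≤ a → a + 1ℤ ≤ p + (y - x) → x ∈[ lo , hi ] → y ∈[ lo , hi ] →
              p + (y - x) ∈[ a + 1ℤ , i ]
    offset∈ {p} {x} {y} p≤a a+1≤ (lo≤x , _) (_ , y≤hi) =
      a+1≤ , ≤-by (diff p≤a ⊕ diff lo≤x ⊕ diff y≤hi ⊕ diff< narrow ⊕ one)
                  (solve (p ∷ x ∷ y ∷ a ∷ i ∷ lo ∷ hi ∷ []))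

    a-offset∈ : ∀ {x y} → x < y → x ∈[ lo , hi ] → y ∈[ lo , hi ] → a + (y - x) ∈[ a + 1ℤ , i ]
    a-offset∈ {x} {y} x<y = offset∈ ≤-refl (≤-by (diff< x<y) (solve (a ∷ x ∷ y ∷ [])))

    w-inside-m : ew < em → ⊥
    w-inside-m ew<em = dm≢0 (Uw dm (matches-mono bm+1≤a (<⇒≤ ew<em) Wm))

    m-same-shift-as-l : dl ≡ dm → ⊥
    m-same-shift-as-l dl≡dm =
      dm≢0 (Um dm (matches-cons (subst (λ d → f bm ≡ f (bm + d)) dl≡dm (Wl bm bm∈Wl)) Wm))

    w-same-shift : ∀ {d b e} → b < a → i ≤ e → Matches f d (b + 1ℤ) e → d ≡ dw → ⊥
    w-same-shift b<a i≤e M refl = dw≢0 (Uw dw (matches-cons (M a (covered b<a i≤e (≤-refl , <⇒≤ a<i))) Ww))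

    w-not-lowest : ∀ {dα bα eα dX bX eX} → dα ∈[ lo , hi ] → dX ∈[ lo , hi ] →
                   dα < dX → dα < dw → bα < a → i ≤ eα → bX < a → i ≤ eX →
                   Matches f dα (bα + 1ℤ) eα → Matches f dX (bX + 1ℤ) eX → ⊥
    w-not-lowest {dα} {dX = dX} dα∈ dX∈ dα<dX dα<dw bα<a i≤eα bX<a i≤eX Wα WX =
      dw≢0 (Uw dw (matches-cons (matches-via Wα WX Ww
        (covered bX<a i≤eX (≤-refl , <⇒≤ a<i))
        (covered bα<a i≤eα (∈-weakenˡ δ∈)) (in-Ww δ∈)
        (covered bα<a i≤eα (∈-weakenˡ ε∈)) (covered bX<a i≤eX (∈-weakenˡ ε∈))) Ww))
      where
      δ∈ : a + (dX - dα) ∈[ a + 1ℤ , i ]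
      δ∈ = a-offset∈ dα<dX dα∈ dX∈
      ε∈ : a + (dw - dα) ∈[ a + 1ℤ , i ]
      ε∈ = a-offset∈ dα<dw dα∈ dw∈

    -- Past el, the window of l is replaced by that of w: the (dl - dw)-period of the
    -- image of w propagates along its (dm - dw)-period, so M_m recurs at shift dl.
    w-lowest-l-middle : dw < dl → dl < dm → em ≤ ew → ⊥
    w-lowest-l-middle dw<dl dl<dm em≤ew = dl≢0 (Um dl m-matches-at-dl)
      where
      bl+1≤a+1 : bl + 1ℤ ≤ a + 1ℤ
      bl+1≤a+1 = +-monoˡ-≤ 1ℤ (<⇒≤ bl<a)

      bm+1≤a+1 : bm + 1ℤ ≤ a + 1ℤ
      bm+1≤a+1 = +-monoˡ-≤ 1ℤ (<⇒≤ bm<a)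

      a+1+P≤i+1 : a + 1ℤ + (dm - dw) ≤ i + 1ℤ
      a+1+P≤i+1 = ≤-by (diff< narrow ⊕ diff (proj₁ dw∈) ⊕ diff (proj₂ dm∈) ⊕ one)
                       (solve (a ∷ i ∷ lo ∷ hi ∷ dm ∷ dw ∷ []))

      em+Q≤em+P : em + (dl - dw) ≤ em + (dm - dw)
      em+Q≤em+P = ≤-by (diff< dl<dm ⊕ one) (solve (em ∷ dl ∷ dm ∷ dw ∷ []))

      Q-period : Matches (λ r → f (r + dw)) (dl - dw) (a + 1ℤ) em
      Q-period = matches-extendʳ (0<-diff (<-trans dw<dl dl<dm)) (<⇒≤ (0<-diff dw<dl)) a+1+P≤i+1 em+Q≤em+P
        (matches-far Ww Wl ≤-refl bl+1≤a+1 i≤ew i≤el)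
        (matches-far Ww Wm ≤-refl bm+1≤a+1 em≤ew ≤-refl)

      m-matches-at-dl : Matches f dl bm em
      m-matches-at-dl q (bm≤q , q≤em) with q ≤? el
      ... | yes q≤el = Wl q (≤-trans bl+1≤bm bm≤q , q≤el)
      ... | no q≰el = begin
        f q                     ≡⟨ Ww q (a+1≤q , ≤-trans q≤em em≤ew) ⟩
        f (q + dw)              ≡⟨ Q-period q (a+1≤q , q≤em) ⟩
        f (q + (dl - dw) + dw)  ≡⟨ cong f (solve (q ∷ dl ∷ dw ∷ [])) ⟩
        f (q + dl)              ∎
        where
        a+1≤q : a + 1ℤ ≤ q
        a+1≤q = ≤-by (diff< (≰⇒> q≰el) ⊕ diff i≤el ⊕ diff< a<i ⊕ one) (solve (a ∷ i ∷ el ∷ q ∷ []))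

    m-shift-lands-in-Ww : dw < dm → dm < dl → a + 1ℤ ≤ bm + (dm - dw) → ⊥
    m-shift-lands-in-Ww dw<dm dm<dl a+1≤bm+P = dm≢0 (Um dm (matches-cons (matches-via Ww Wl Wm bm∈Wl
        (in-Ww δ∈) (covered bm<a i≤em (∈-weakenˡ δ∈)) (in-Ww ε∈) (covered bl<a i≤el (∈-weakenˡ ε∈))) Wm))
      where
      a+1≤bm+δ : a + 1ℤ ≤ bm + (dl - dw)
      a+1≤bm+δ = ≤-by (diff a+1≤bm+P ⊕ diff< dm<dl ⊕ one) (solve (a ∷ bm ∷ dl ∷ dm ∷ dw ∷ []))
      δ∈ : bm + (dl - dw) ∈[ a + 1ℤ , i ]
      δ∈ = offset∈ (<⇒≤ bm<a) a+1≤bm+δ dw∈ dl∈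
      ε∈ : bm + (dm - dw) ∈[ a + 1ℤ , i ]
      ε∈ = offset∈ (<⇒≤ bm<a) a+1≤bm+P dw∈ dm∈

    -- The period dm - dw seen right of a is pushed left to bm through the period dl - dm.
    period-from-bm : dw < dm → dm < dl → bm + (dm - dw) ≤ a →
                     ∀ {U} → i ≤ U + (dm - dw) → U ≤ em → U + (dm - dw) ≤ ew → Matches f (dm - dw) bm U
    period-from-bm dw<dm dm<dl bm+P≤a {U} i≤U+P U≤em U+P≤ew =
      matches-extendˡ (0<-diff dm<dl) (<⇒≤ (0<-diff dw<dm)) mid+P≤ mid+R≤
      (matches-near Ww Wm bm+1≤mid U≤em a+1≤mid+P U+P≤ew)
      (matches-near Wm Wl bl+1≤bm i-R≤el bm+1≤bm+R i-R+R≤em)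
      where
      bm+1≤mid : bm + 1ℤ ≤ a + 1ℤ - (dm - dw)
      bm+1≤mid = ≤-by (diff bm+P≤a) (solve (a ∷ bm ∷ dm ∷ dw ∷ []))
      a+1≤mid+P : a + 1ℤ ≤ a + 1ℤ - (dm - dw) + (dm - dw)
      a+1≤mid+P = ≤-reflexive (solve (a ∷ dm ∷ dw ∷ []))
      mid+P≤ : a + 1ℤ - (dm - dw) + (dm - dw) ≤ i - (dl - dm) + 1ℤ
      mid+P≤ = ≤-by (diff< narrow ⊕ diff (proj₁ dm∈) ⊕ diff (proj₂ dl∈) ⊕ one)
                    (solve (a ∷ i ∷ lo ∷ hi ∷ dl ∷ dm ∷ dw ∷ []))
      mid+R≤ : a + 1ℤ - (dm - dw) + (dl - dm) ≤ U + 1ℤ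
      mid+R≤ = ≤-by (diff i≤U+P ⊕ diff< narrow ⊕ diff (proj₁ dm∈) ⊕ diff (proj₂ dl∈) ⊕ one)
                    (solve (a ∷ i ∷ lo ∷ hi ∷ dl ∷ dm ∷ dw ∷ U ∷ []))
      i-R≤el : i - (dl - dm) ≤ el
      i-R≤el = ≤-by (diff i≤el ⊕ diff< dm<dl ⊕ one) (solve (i ∷ el ∷ dl ∷ dm ∷ []))
      bm+1≤bm+R : bm + 1ℤ ≤ bm + (dl - dm)
      bm+1≤bm+R = ≤-by (diff< dm<dl) (solve (bm ∷ dl ∷ dm ∷ []))
      i-R+R≤em : i - (dl - dm) + (dl - dm) ≤ em
      i-R+R≤em = ≤-by (diff i≤em) (solve (i ∷ em ∷ dl ∷ dm ∷ []))

    -- M_m then recurs at shift dm - dw unless that runs past ew, and then M_w recurs at dw - dm.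
    m-shift-lands-before-Ww : dw < dm → dm < dl → em ≤ ew → bm + (dm - dw) ≤ a → ⊥
    m-shift-lands-before-Ww dw<dm dm<dl em≤ew bm+P≤a with em + (dm - dw) ≤? ew
    ... | yes em+P≤ew =
      <⇒≢ (0<-diff dw<dm) (sym (Um (dm - dw) (period-from-bm dw<dm dm<dl bm+P≤a i≤em+P ≤-refl em+P≤ew)))
      where
      i≤em+P : i ≤ em + (dm - dw)
      i≤em+P = ≤-by (diff i≤em ⊕ diff< dw<dm ⊕ one) (solve (i ∷ em ∷ dm ∷ dw ∷ []))
    ... | no em+P≰ew = <⇒≢ (neg-mono-< (0<-diff dw<dm)) (Uw (- (dm - dw))
            (matches-mono bm+P≤a (≤-reflexive (sym ew-P+P≡ew))
              (matches-neg (period-from-bm dw<dm dm<dl bm+P≤a i≤ew-P+P ew-P≤em (≤-reflexive ew-P+P≡ew)))))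
      where
      ew-P+P≡ew : ew - (dm - dw) + (dm - dw) ≡ ew
      ew-P+P≡ew = solve (ew ∷ dm ∷ dw ∷ [])
      i≤ew-P+P : i ≤ ew - (dm - dw) + (dm - dw)
      i≤ew-P+P = ≤-by (diff i≤ew) (solve (i ∷ ew ∷ dm ∷ dw ∷ []))
      ew-P≤em : ew - (dm - dw) ≤ em
      ew-P≤em = ≤-by (diff< (≰⇒> em+P≰ew) ⊕ one) (solve (ew ∷ em ∷ dm ∷ dw ∷ []))

    three-windows⊥ : ⊥
    three-windows⊥ with em ≤? ew
    ... | no em≰ew = w-inside-m (≰⇒> em≰ew)
    ... | yes em≤ew with <-cmp dl dm
    ...   | tri≈ _ dl≡dm _ = m-same-shift-as-l dl≡dm
    ...   | tri< dl<dm _ _ with <-cmp dl dw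
    ...     | tri< dl<dw _ _ = w-not-lowest dl∈ dm∈ dl<dm dl<dw bl<a i≤el bm<a i≤em Wl Wm
    ...     | tri≈ _ dl≡dw _ = w-same-shift bl<a i≤el Wl dl≡dw
    ...     | tri> _ _ dw<dl = w-lowest-l-middle dw<dl dl<dm em≤ew
    three-windows⊥ | yes em≤ew | tri> _ _ dm<dl with <-cmp dm dw
    ...     | tri< dm<dw _ _ = w-not-lowest dm∈ dl∈ dm<dl dm<dw bm<a i≤em bl<a i≤el Wm Wl
    ...     | tri≈ _ dm≡dw _ = w-same-shift bm<a i≤em Wm dm≡dw
    ...     | tri> _ _ dw<dm with a + 1ℤ ≤? bm + (dm - dw)
    ...       | yes a+1≤bm+P = m-shift-lands-in-Ww dw<dm dm<dl a+1≤bm+P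
    ...       | no a+1≰bm+P = m-shift-lands-before-Ww dw<dm dm<dl em≤ew
                                (≤-by (diff< (≰⇒> a+1≰bm+P)) (solve (a ∷ bm ∷ dm ∷ dw ∷ [])))

  -- Reading outside [0 .. n-1] gives nothing, so that shifted reads may fall off the string.
  at : ∀ {A : Set} {n} → Vec A n → ℤ → Maybe A
  at {n = n} T (+ m) with m ℕ.<? n
  ... | yes m<n = just (lookup T (fromℕ< m<n))
  ... | no _    = nothing
  at T -[1+ _ ] = nothing

  module _ {A : Set} {n : ℕ} (T : Vec A n) where

    at-inside : ∀ {m} (m<n : m ℕ.< n) → at T (+ m) ≡ just (lookup T (fromℕ< m<n))
    at-inside {m} m<n with m ℕ.<? n
    ... | yes m<n′ = cong (λ m<n → just (lookup T (fromℕ< m<n))) (ℕₚ.<-irrelevant m<n′ m<n)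
    ... | no m≮n   = ⊥-elim (m≮n m<n)

    at-just : ∀ {x c} → at T x ≡ just c → ∃[ m ] x ≡ + m × m ℕ.< n
    at-just {+ m} eq with m ℕ.<? n
    at-just {+ m} eq | yes m<n = m , refl , m<n
    at-just {+ m} () | no _
    at-just { -[1+ _ ]} ()

    occAt⇒at : ∀ {k len p t} → OccAt T k len p → t ℕ.< len → at T (+ (k ℕ.+ t)) ≡ at T (+ (p ℕ.+ t))
    occAt⇒at {k} {len} {p} {t} (k+len≤n , p+len≤n , same) t<len = begin
      at T (+ (k ℕ.+ t))              ≡⟨ at-inside k+t<n ⟩
      just (lookup T (fromℕ< k+t<n))  ≡⟨ cong just (same t t<len k+t<n p+t<n) ⟩
      just (lookup T (fromℕ< p+t<n))  ≡⟨ at-inside p+t<n ⟨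
      at T (+ (p ℕ.+ t))              ∎
      where
      k+t<n : k ℕ.+ t ℕ.< n
      k+t<n = ℕₚ.<-≤-trans (ℕₚ.+-monoʳ-< k t<len) k+len≤n
      p+t<n : p ℕ.+ t ℕ.< n
      p+t<n = ℕₚ.<-≤-trans (ℕₚ.+-monoʳ-< p t<len) p+len≤n

    occAt⇒matches : ∀ {b e j} → OccAt T (suc b) (e ℕ.∸ b) j → Matches (at T) (+ j - + b - 1ℤ) (+ b + 1ℤ) (+ e)
    occAt⇒matches {b} {e} {j} occ (+ m) (b+1≤m , m≤e) = begin
      at T (+ m)                       ≡⟨ cong (at T ∘ +_) 1+b+t≡m ⟨
      at T (+ (suc b ℕ.+ t))           ≡⟨ occAt⇒at occ t<e-b ⟩
      at T (+ (j ℕ.+ t))               ≡⟨ cong (at T) shifted ⟩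
      at T (+ m + (+ j - + b - 1ℤ))    ∎
      where
      t : ℕ
      t = m ℕ.∸ suc b
      1+b≤m : suc b ℕ.≤ m
      1+b≤m = subst (ℕ._≤ m) (ℕₚ.+-comm b 1) (drop‿+≤+ b+1≤m)
      1+b+t≡m : suc b ℕ.+ t ≡ m
      1+b+t≡m = ℕₚ.m+[n∸m]≡n 1+b≤m
      t<e-b : t ℕ.< e ℕ.∸ b
      t<e-b = ℕₚ.m+n≤o⇒m≤o∸n (suc t) {b}
                (subst (ℕ._≤ e) (sym (trans (cong suc (ℕₚ.+-comm t b)) 1+b+t≡m)) (drop‿+≤+ m≤e))
      realign : ∀ J B T′ → J + T′ ≡ (1ℤ + B + T′) + (J - B - 1ℤ)
      realign J B T′ = solve (J ∷ B ∷ T′ ∷ [])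
      shifted : + (j ℕ.+ t) ≡ + m + (+ j - + b - 1ℤ)
      shifted = begin
        + (j ℕ.+ t)                          ≡⟨ pos-+ j t ⟩
        + j + + t                            ≡⟨ realign (+ j) (+ b) (+ t) ⟩
        (1ℤ + + b + + t) + (+ j - + b - 1ℤ)  ≡⟨ cong (λ x → x + (+ j - + b - 1ℤ))
                                                     (trans (sym (pos-+ (suc b) t)) (cong +_ 1+b+t≡m)) ⟩
        + m + (+ j - + b - 1ℤ)               ∎
    occAt⇒matches occ -[1+ _ ] (() , _)

    uniqueSub⇒unique : ∀ {b e} → b ℕ.≤ e → UniqueSub T b (suc e ℕ.∸ b) → Unique (at T) (+ b) (+ e)
    uniqueSub⇒unique {b} {e} b≤e (b+len≤n , only) d M =
      +-identityʳ-unique (+ b) d (trans b+d≡p (cong +_ (only p occurs-at-p)))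
      where
      len : ℕ
      len = suc e ℕ.∸ b
      b≤1+e : b ℕ.≤ suc e
      b≤1+e = ℕₚ.m≤n⇒m≤1+n b≤e
      e<n : e ℕ.< n
      e<n = subst (ℕ._≤ n) (ℕₚ.m+[n∸m]≡n b≤1+e) b+len≤n

      lands : ∀ {m} → b ℕ.≤ m → m ℕ.≤ e → ∃[ p ] + m + d ≡ + p × p ℕ.< n
      lands {m} b≤m m≤e = at-just (trans (sym (M (+ m) (+≤+ b≤m , +≤+ m≤e))) (at-inside (ℕₚ.≤-<-trans m≤e e<n)))

      p : ℕ
      p = proj₁ (lands ℕₚ.≤-refl b≤e)
      b+d≡p : + b + d ≡ + p
      b+d≡p = proj₁ (proj₂ (lands ℕₚ.≤-refl b≤e))
      p′ : ℕ
      p′ = proj₁ (lands b≤e ℕₚ.≤-refl)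
      e+d≡p′ : + e + d ≡ + p′
      e+d≡p′ = proj₁ (proj₂ (lands b≤e ℕₚ.≤-refl))
      p′<n : p′ ℕ.< n
      p′<n = proj₂ (proj₂ (lands b≤e ℕₚ.≤-refl))

      len≡ : + len ≡ 1ℤ + + e - + b
      len≡ = sym (trans (m-n≡m⊖n (suc e) b) (⊖-≥ b≤1+e))

      realign : ∀ B D E → (B + D) + (1ℤ + E - B) ≡ 1ℤ + (E + D)
      realign B D E = solve (B ∷ D ∷ E ∷ [])

      p+len≤n : p ℕ.+ len ℕ.≤ n
      p+len≤n = subst (ℕ._≤ n) (sym (+-injective (begin
        + (p ℕ.+ len)                  ≡⟨ pos-+ p len ⟩
        + p + + len                    ≡⟨ cong₂ _+_ (sym b+d≡p) len≡ ⟩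
        (+ b + d) + (1ℤ + + e - + b)   ≡⟨ realign (+ b) d (+ e) ⟩
        1ℤ + (+ e + d)                 ≡⟨ cong (λ x → 1ℤ + x) e+d≡p′ ⟩
        + suc p′                       ∎))) p′<n

      moved : ∀ t → + (b ℕ.+ t) + d ≡ + (p ℕ.+ t)
      moved t = begin
        + (b ℕ.+ t) + d   ≡⟨ cong (_+ d) (pos-+ b t) ⟩
        + b + + t + d     ≡⟨ swap (+ b) (+ t) d ⟩
        (+ b + d) + + t   ≡⟨ cong (_+ + t) b+d≡p ⟩
        + p + + t         ≡⟨ pos-+ p t ⟨
        + (p ℕ.+ t)       ∎
        where
        swap : ∀ B T′ D → B + T′ + D ≡ (B + D) + T′
        swap B T′ D = solve (B ∷ T′ ∷ D ∷ [])

      occurs-at-p : OccAt T b len p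
      occurs-at-p = b+len≤n , p+len≤n , λ t t<len b+t<n p+t<n → just-injective (begin
        just (lookup T (fromℕ< b+t<n))  ≡⟨ at-inside b+t<n ⟨
        at T (+ (b ℕ.+ t))              ≡⟨ M (+ (b ℕ.+ t)) (+≤+ (ℕₚ.m≤m+n b t) , +≤+ (b+t≤e t<len)) ⟩
        at T (+ (b ℕ.+ t) + d)          ≡⟨ cong (at T) (moved t) ⟩
        at T (+ (p ℕ.+ t))              ≡⟨ at-inside p+t<n ⟩
        just (lookup T (fromℕ< p+t<n))  ∎)
        where
        b+t≤e : ∀ {t} → t ℕ.< len → b ℕ.+ t ℕ.≤ e
        b+t≤e {t} t<len = ℕₚ.≤-pred (subst (b ℕ.+ t ℕ.<_) (ℕₚ.m+[n∸m]≡n b≤1+e) (ℕₚ.+-monoʳ-< b t<len))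

  module _ {a ℓ₁ ℓ₂} (O : StrictTotalOrder a ℓ₁ ℓ₂) where
    open StrictTotalOrder O using (Carrier; _≈_; compare) renaming (_<_ to _≺_)

    increasing⊥⇒distinct⊥ : ∀ {p} (P : Carrier → Set p) →
                            (∀ {x y z} → x ≺ y → y ≺ z → P x → P y → P z → ⊥) →
                            ∀ {x y z} → ¬ x ≈ y → ¬ y ≈ z → ¬ x ≈ z → P x → P y → P z → ⊥
    increasing⊥⇒distinct⊥ P sorted⊥ {x} {y} {z} x≉y y≉z x≉z px py pz
      with compare x y | compare y z | compare x z
    ... | tri≈ _ x≈y _ | _              | _              = x≉y x≈y
    ... | _            | tri≈ _ y≈z _   | _              = y≉z y≈z
    ... | _            | _              | tri≈ _ x≈z _   = x≉z x≈z
    ... | tri< x<y _ _ | tri< y<z _ _   | _              = sorted⊥ x<y y<z px py pz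
    ... | tri< x<y _ _ | tri> _ _ z<y   | tri< x<z _ _   = sorted⊥ x<z z<y px pz py
    ... | tri< x<y _ _ | tri> _ _ z<y   | tri> _ _ z<x   = sorted⊥ z<x x<y pz px py
    ... | tri> _ _ y<x | tri< y<z _ _   | tri< x<z _ _   = sorted⊥ y<x x<z py px pz
    ... | tri> _ _ y<x | tri< y<z _ _   | tri> _ _ z<x   = sorted⊥ y<z z<x py pz px
    ... | tri> _ _ y<x | tri> _ _ z<y   | _              = sorted⊥ z<y y<x pz py px

  increasing-gap : ∀ {m} (g : Fin (suc m) → ℕ) → (∀ k l → k F.< l → g k ℕ.< g l) →
                   ∀ k → g k ℕ.+ m ℕ.≤ toℕ k ℕ.+ g (fromℕ m)
  increasing-gap {zero} g mono F.zero = ℕₚ.≤-reflexive (ℕₚ.+-identityʳ (g F.zero))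
  increasing-gap {suc m} g mono F.zero = ℕₚ.≤-trans
    (ℕₚ.≤-trans (ℕₚ.≤-reflexive (ℕₚ.+-suc (g F.zero) m))
                (ℕₚ.+-monoˡ-≤ m (mono F.zero (F.suc F.zero) (ℕ.s≤s ℕ.z≤n))))
    (increasing-gap (g ∘ F.suc) (λ k l k<l → mono (F.suc k) (F.suc l) (ℕ.s<s k<l)) F.zero)
  increasing-gap {suc m} g mono (F.suc k) = ℕₚ.≤-trans
    (ℕₚ.≤-reflexive (ℕₚ.+-suc (g (F.suc k)) m))
    (ℕ.s≤s (increasing-gap (g ∘ F.suc) (λ k l k<l → mono (F.suc k) (F.suc l) (ℕ.s<s k<l)) k))

  x-y-1≡0⇒x≡1+y : ∀ {x y} → x - y - 1ℤ ≡ 0ℤ → x ≡ 1ℤ + y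
  x-y-1≡0⇒x≡1+y {x} {y} eq = begin
    x                        ≡⟨ solve (x ∷ y ∷ []) ⟩
    (x - y - 1ℤ) + (1ℤ + y)  ≡⟨ cong (_+ (1ℤ + y)) eq ⟩
    0ℤ + (1ℤ + y)            ≡⟨ +-identityˡ (1ℤ + y) ⟩
    1ℤ + y                   ∎

  narrow-by-gap : ∀ {B H W I M x} → B + H ≤ W + I → W ≤ M → x ≤ H - (1ℤ + M) → B + x < I
  narrow-by-gap {B} {H} {W} {I} {M} {x} gap W≤M x≤ =
    <-by (diff gap ⊕ diff W≤M ⊕ diff x≤) (solve (B ∷ H ∷ W ∷ I ∷ M ∷ x ∷ []))

  position-diff : ∀ I J B J′ B′ →
                  (J′ + (I - B′ - 1ℤ)) - (J + (I - B - 1ℤ)) ≡ (J′ - B′ - 1ℤ) - (J - B - 1ℤ)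
  position-diff I J B J′ B′ = solve (I ∷ J ∷ B ∷ J′ ∷ B′ ∷ [])

  consecutive< : ∀ {m} {x y : Fin m} → toℕ y ≡ suc (toℕ x) → x F.< y
  consecutive< {x = x} y≡1+x = subst (toℕ x ℕ.<_) (sym y≡1+x) (ℕₚ.n<1+n (toℕ x))

  permutation-distinct : ∀ {m} (π : Permutation′ m) {x y} → x F.< y → π ⟨$⟩ʳ x ≢ π ⟨$⟩ʳ y
  permutation-distinct π x<y = Fₚ.<⇒≢ x<y ∘ Injection.injective (↔⇒↣ π)

  module MUSFamily {A : Set} {n : ℕ} (T : Vec A n) (i h : ℕ) (b e : Fin (suc h) → ℕ)
    (mus : ∀ k → IsMUS T (b k) (e k)) (cont : ∀ k → Contains (b k) (e k) i)
    (mono : ∀ k l → k F.< l → b k ℕ.< b l) (j : Fin h → ℕ)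
    (occ : ∀ k → OccAt T (suc (b (inject₁ k))) (e (inject₁ k) ℕ.∸ b (inject₁ k)) (j k))
    (j≢ : ∀ k → j k ≢ suc (b (inject₁ k)))
    where

    d : Fin h → ℤ
    d k = + j k - + b (inject₁ k) - 1ℤ

    Close : ℤ → ℤ → ℕ → Fin h → Set
    Close lo hi m k = d k ∈[ lo , hi ] × toℕ k ℕ.≤ m

    increasing-close⊥ : ∀ {lo hi m} → hi - lo ≤ + h - + suc m →
                        ∀ {k l w} → k F.< l → l F.< w → Close lo hi m k → Close lo hi m l → Close lo hi m w → ⊥
    increasing-close⊥ {lo} {hi} {m} spread {k} {l} {w} k<l l<w (dk∈ , _) (dl∈ , _) (dw∈ , w≤m) =
      ThreeWindows.three-windows⊥ (at T) (begins< k<l) (begins< l<w) (i≤end k) (i≤end l) (i≤end w)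
        dk∈ dl∈ dw∈ (narrow-by-gap {B = + b (inject₁ w)} {H = + h} {M = + m} (gap w) (+≤+ w≤m) spread)
        (window k) (window l) (window w) (d≢0 k) (d≢0 l) (d≢0 w) (unique l) (unique w)
      where
      begins< : ∀ {k l} → k F.< l → + b (inject₁ k) < + b (inject₁ l)
      begins< {k} {l} k<l = +<+ (mono _ _ (subst₂ ℕ._<_ (sym (Fₚ.toℕ-inject₁ k)) (sym (Fₚ.toℕ-inject₁ l)) k<l))

      i≤end : ∀ k → + i ≤ + e (inject₁ k)
      i≤end k = +≤+ (proj₂ (cont (inject₁ k)))

      window : ∀ k → Matches (at T) (d k) (+ b (inject₁ k) + 1ℤ) (+ e (inject₁ k))
      window k = occAt⇒matches T (occ k)

      unique : ∀ k → Unique (at T) (+ b (inject₁ k)) (+ e (inject₁ k))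
      unique k = uniqueSub⇒unique T (proj₁ (mus (inject₁ k))) (proj₁ (proj₂ (mus (inject₁ k))))

      d≢0 : ∀ k → d k ≢ 0ℤ
      d≢0 k d≡0 = j≢ k (+-injective (x-y-1≡0⇒x≡1+y {y = + b (inject₁ k)} d≡0))

      gap : ∀ w → + b (inject₁ w) + + h ≤ + toℕ w + + i
      gap w = subst₂ _≤_ (pos-+ _ h) (pos-+ (toℕ w) i) (+≤+ (ℕₚ.≤-trans
        (increasing-gap b mono (inject₁ w))
        (ℕₚ.+-mono-≤ (ℕₚ.≤-reflexive (Fₚ.toℕ-inject₁ w)) (proj₁ (cont (fromℕ h))))))

    pos : Fin h → ℤ
    pos k = + j k + (+ i - + b (inject₁ k) - 1ℤ)

    pos-diff : ∀ k l → pos l - pos k ≡ d l - d k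
    pos-diff k l = position-diff (+ i) (+ j k) (+ b (inject₁ k)) (+ j l) (+ b (inject₁ l))

    pos≤⇒d≤ : ∀ {k l} → pos k ≤ pos l → d k ≤ d l
    pos≤⇒d≤ {k} {l} pk≤pl = ≤-by (diff pk≤pl) (pos-diff k l)

    sorted-shifts⊥ : ∀ {k l w} → k ≢ l → l ≢ w → k ≢ w → d k ≤ d l → d l ≤ d w →
                     d w - d k ≤ + h - + suc (toℕ k ⊔ toℕ l ⊔ toℕ w) → ⊥
    sorted-shifts⊥ {k} {l} {w} k≢l l≢w k≢w dk≤dl dl≤dw spread =
      increasing⊥⇒distinct⊥ (Fₚ.<-strictTotalOrder h) (Close (d k) (d w) (toℕ k ⊔ toℕ l ⊔ toℕ w))
        (increasing-close⊥ spread) k≢l l≢w k≢w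
        ((≤-refl , dk≤dw) , ℕₚ.≤-trans (ℕₚ.m≤m⊔n (toℕ k) (toℕ l)) (ℕₚ.m≤m⊔n _ (toℕ w)))
        ((dk≤dl , dl≤dw) , ℕₚ.≤-trans (ℕₚ.m≤n⊔m (toℕ k) (toℕ l)) (ℕₚ.m≤m⊔n _ (toℕ w)))
        ((dk≤dw , ≤-refl) , ℕₚ.m≤n⊔m (toℕ k ⊔ toℕ l) (toℕ w))
      where
      dk≤dw : d k ≤ d w
      dk≤dw = ≤-trans dk≤dl dl≤dw

open import Data.Integer.Properties using (≰⇒>)
open import Data.Nat using (ℕ; suc; _≤_; _<_; _⊔_; _∸_)
open import Data.Nat.Properties using (<⇒≤; <-trans)

lemma2 : {A : Set} (n : ℕ) (T : Vec A n) (i : ℕ) → i < n →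
  (h : ℕ) → 1 ≤ h →
  (b e : Fin (suc h) → ℕ) →
  (∀ k → IsMUS T (b k) (e k)) →
  (∀ k → Contains (b k) (e k) i) →
  (∀ k l → k F.< l → b k < b l) →
  (j : Fin h → ℕ) →
  (∀ k → OccAt T (suc (b (inject₁ k))) (e (inject₁ k) ∸ b (inject₁ k)) (j k)) →
  (∀ k → j k ≢ suc (b (inject₁ k))) →
  (f : Permutation′ h) →
  let I : Fin h → ℤ
      I k = (+ j k) Z.+ ((+ i) - (+ b (inject₁ k)) - (+ 1))
  in
  (∀ x y → x F.≤ y → I (f ⟨$⟩ʳ x) Z.≤ I (f ⟨$⟩ʳ y)) →
  ∀ (x y z : Fin h) → toℕ y ≡ suc (toℕ x) → toℕ z ≡ suc (toℕ y) →
  (+ h) - (+ suc (toℕ (f ⟨$⟩ʳ x) ⊔ toℕ (f ⟨$⟩ʳ y) ⊔ toℕ (f ⟨$⟩ʳ z)))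
    Z.< I (f ⟨$⟩ʳ z) - I (f ⟨$⟩ʳ x)
lemma2 _ T i _ h _ b e mus cont mono j occ j≢ π sorted x y z y≡1+x z≡1+y = ≰⇒> λ spread →
  sorted-shifts⊥ (permutation-distinct π x<y) (permutation-distinct π y<z) (permutation-distinct π x<z)
    (pos≤⇒d≤ (sorted x y (<⇒≤ x<y))) (pos≤⇒d≤ (sorted y z (<⇒≤ y<z)))
    (subst (λ t → t Z.≤ _) (pos-diff (π ⟨$⟩ʳ x) (π ⟨$⟩ʳ z)) spread)
  where
  open MUSFamily T i h b e mus cont mono j occ j≢
  x<y : x F.< y
  x<y = consecutive< y≡1+x
  y<z : y F.< z
  y<z = consecutive< z≡1+y
  x<z : x F.< z
  x<z = <-trans x<y y<z
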